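{- Let $A$ and $B$ be abelian groups with $B$ finite. Let $G$ be a finite graph in which every edge is contained in a cycle of length at most $|B|-1$. Suppose $G$ admits a nowhere-zero $(A\times B)$-flow $(a,b)$ with $\mathrm{supp}(b)\ne E(G)$. Then there is a nowhere-zero $(A\times B)$-flow $(a,b')$ adjacent to $(a,b)$ in $\mathcal{F}(G,A\times B)$ such that $|\mathrm{supp}(b')|>|\mathrm{supp}(b)|$.
   Context: Graphs may have multiple edges but no loops; $G$ has a fixed orientation. For an abelian group $\Gamma$, a $\Gamma$-flow is a map $f:E(G)\to\Gamma$ such that at each vertex the sum of values on outgoing arcs equals the sum on incoming arcs; nowhere-zero means no edge receives $0_\Gamma$; $\mathrm{supp}(f)=\{e: f(e)\ne 0_\Gamma\}$. An $(A\times B)$-flow is written as a pair $(a,b)$ of an $A$-flow $a$ and a $B$-flow $b$; it is nowhere-zero iff for every edge $e$, $a(e)\ne0_A$ or $b(e)\ne0_B$. A cycle is a connected 2-regular subgraph. $\mathcal{F}(G,\Gamma)$ is the graph whose vertices are the nowhere-zero $\Gamma$-flows of $G$, two flows $f,g$ adjacent iff $\mathrm{supp}(f-g)$ is the edge set of a cycle. -}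

module Defs where

open import Level using (Level; _⊔_)
open import Data.Nat using (ℕ; zero; suc; _+_)
open import Data.Fin using (Fin; zero; suc; _≟_)
open import Data.Bool using (Bool; true; false)
open import Data.Product using (Σ; _×_; _,_; ∃)
open import Data.Sum using (_⊎_)
open import Relation.Nullary using (¬_; Dec; yes; no)
open import Relation.Binary.PropositionalEquality as ≡ using (_≡_; _≢_)
open import Algebra.Bundles using (AbelianGroup)
open import Function.Bundles using (Inverse; _⇔_)

-- Finite directed multigraphs without loops (a fixed orientation).
-- Vertices are Fin nV, edges (arcs) are Fin nE; arc e goes from
-- tail e to head e.

record Graph : Set where
  field
    nV nE    : ℕ
    tail     : Fin nE → Fin nV
    head     : Fin nE → Fin nV
    loopless : ∀ e → tail e ≢ head e

count : ∀ {m} → (Fin m → Bool) → ℕ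
count {zero}  S = 0
count {suc m} S with S zero
... | true  = suc (count (λ i → S (suc i)))
... | false = count (λ i → S (suc i))

module _ (G : Graph) where
  open Graph G

  [_] : ∀ {p} {P : Set p} → Dec P → ℕ
  [ yes _ ] = 1
  [ no  _ ] = 0

  -- number of edges of S incident with v, i.e. the degree of v in the
  -- spanning subgraph with edge set S (no loops, so each edge is counted
  -- once at each of its two ends)
  deg : (Fin nE → Bool) → Fin nV → ℕ
  deg S v = go nE (λ e → e)
    where
    go : (k : ℕ) → (Fin k → Fin nE) → ℕ
    go zero    ι = 0
    go (suc k) ι with S (ι zero)
    ... | true  = [ tail (ι zero) ≟ v ] + [ head (ι zero) ≟ v ]
                  + go k (λ i → ι (suc i))
    ... | false = go k (λ i → ι (suc i))

  data Reach (S : Fin nE → Bool) : Fin nV → Fin nV → Set where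
    here : ∀ {u} → Reach S u u
    fwd  : ∀ {w} e → S e ≡ true → Reach S (head e) w → Reach S (tail e) w
    bwd  : ∀ {w} e → S e ≡ true → Reach S (tail e) w → Reach S (head e) w

  -- S is the edge set of a cycle (a connected 2-regular subgraph):
  -- S is nonempty, every vertex has degree 0 or 2 in S (the vertices of
  -- degree 0 are not in the subgraph), and the subgraph is connected.
  IsCycle : (Fin nE → Bool) → Set
  IsCycle S =
    (∃ λ e → S e ≡ true)
    × (∀ v → deg S v ≡ 0 ⊎ deg S v ≡ 2)
    × (∀ e e′ → S e ≡ true → S e′ ≡ true → Reach S (tail e) (tail e′))

  length : (Fin nE → Bool) → ℕ
  length = count

module _ {c ℓ} (Γ : AbelianGroup c ℓ) where
  open AbelianGroup Γ

  sumIf : ∀ {m} {p} {P : Fin m → Set p} → (∀ i → Dec (P i))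
          → (Fin m → Carrier) → Carrier
  sumIf {zero}  d f = ε
  sumIf {suc m} d f with d zero
  ... | yes _ = f zero ∙ sumIf (λ i → d (suc i)) (λ i → f (suc i))
  ... | no  _ = sumIf (λ i → d (suc i)) (λ i → f (suc i))

  module _ (G : Graph) where
    open Graph G

    IsFlow : (Fin nE → Carrier) → Set ℓ
    IsFlow f = ∀ v → sumIf (λ e → tail e ≟ v) f ≈ sumIf (λ e → head e ≟ v) f

-- Finite abelian groups: the carrier (up to ≈) is in bijection with Fin k.
-- Then k = |B|.

Finite : ∀ {c ℓ} → AbelianGroup c ℓ → ℕ → Set (c ⊔ ℓ)
Finite B k = Inverse (AbelianGroup.setoid B) (≡.setoid (Fin k))

finite-dec : ∀ {c ℓ} (B : AbelianGroup c ℓ) {k} → Finite B k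
             → ∀ x y → Dec (AbelianGroup._≈_ B x y)
finite-dec B fin x y with Inverse.to fin x ≟ Inverse.to fin y
... | yes p = yes (trans (sym (Inverse.inverseʳ fin ≡.refl))
                         (Inverse.inverseʳ fin p))
  where open AbelianGroup B
... | no ¬p = no (λ q → ¬p (Inverse.to-cong fin q))

supp : ∀ {c ℓ} (B : AbelianGroup c ℓ) {k} → Finite B k
       → ∀ {m} → (Fin m → AbelianGroup.Carrier B) → (Fin m → Bool)
supp B fin f e with finite-dec B fin (f e) (AbelianGroup.ε B)
... | yes _ = false
... | no  _ = true

-- (A × B)-flows, written as pairs (a , b).

module _ {ca ℓa cb ℓb} (A : AbelianGroup ca ℓa) (B : AbelianGroup cb ℓb)
         (G : Graph) where
  open Graph G
  module A = AbelianGroup A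
  module B = AbelianGroup B

  NowhereZero : (Fin nE → A.Carrier) → (Fin nE → B.Carrier) → Set (ℓa ⊔ ℓb)
  NowhereZero a b = ∀ e → ¬ (a e A.≈ A.ε × b e B.≈ B.ε)

  IsNZFlow : (Fin nE → A.Carrier) → (Fin nE → B.Carrier) → Set (ℓa ⊔ ℓb)
  IsNZFlow a b = IsFlow A G a × IsFlow B G b × NowhereZero a b

  Adjacent : (Fin nE → A.Carrier) → (Fin nE → B.Carrier)
           → (Fin nE → A.Carrier) → (Fin nE → B.Carrier) → Set (ℓa ⊔ ℓb)
  Adjacent a b a′ b′ =
    Σ (Fin nE → Bool) λ S → IsCycle G S ×
      (∀ e → (S e ≡ true) ⇔
             (¬ ((a e A.∙ a′ e A.⁻¹) A.≈ A.ε × (b e B.∙ b′ e B.⁻¹) B.≈ B.ε)))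

-- Take an edge e₀ with b(e₀) = 0 and a cycle C through e₀ of length less than |B|. Every
-- vertex has degree 0 or 2 in C, so C can be oriented with equal in- and out-degree at every
-- vertex (split off the two arcs at a vertex and induct on the number of arcs). For x ∈ B the
-- function that is x on forward arcs of C, −x on backward arcs and 0 elsewhere is then a B-flow.
-- On each edge of C exactly one value of x makes b plus this flow vanish, and on e₀ that value
-- is 0; since C has fewer than |B| edges some x avoids all of them. The new flow b′ is nonzero
-- on C, equal to b off C, so (a, b′) is nowhere zero, differs from (a, b) exactly on C, and its
-- support contains that of b together with e₀.
module Submission where

open import Defs
open import Algebra.Bundles using (AbelianGroup)
open import Data.Bool using (Bool; true; false; if_then_else_)
open import Data.Bool.Properties using (¬-not) renaming (_≟_ to _≟ᵇ_)
open import Data.Fin using (Fin; zero; suc; punchIn; _≟_)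
open import Data.Fin.Properties using (punchInᵢ≢i; ¬∀⟶∃¬)
open import Data.Maybe using (Maybe; just; nothing; is-just)
open import Data.Nat using (ℕ; zero; suc; _+_; _∸_; _≤_; _<_; z≤n; s≤s)
open import Data.Nat.Properties
  using ( +-comm; +-assoc; +-identityʳ; +-cancelˡ-≡; suc-injective; m≤m+n; +-mono-≤; +-mono-<-≤; +-mono-≤-<
        ; <⇒≱; _≤?_; +-0-commutativeMonoid; +-commutativeSemigroup)
open import Data.Product using (Σ; ∃; ∃₂; _×_; _,_; proj₁; proj₂)
open import Data.Sum using (_⊎_; inj₁; inj₂; [_,_]′)
open import Data.Vec.Functional using (removeAt; updateAt)
open import Data.Vec.Functional.Properties using (updateAt-updates; updateAt-minimal)
open import Function using (_∘_)
open import Function.Bundles using (Inverse; _⇔_; mk⇔)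
open import Relation.Nullary using (¬_; Dec; does; yes; no; contradiction)
open import Relation.Nullary.Decidable using (dec-true; dec-false; decidable-stable)
open import Relation.Binary.PropositionalEquality
  using (_≡_; _≢_; refl; sym; trans; cong; cong₂; subst; subst₂; module ≡-Reasoning)
open import Algebra.Properties.CommutativeSemigroup +-commutativeSemigroup using (xy∙z≈y∙xz; interchange)
open import Algebra.Properties.CommutativeMonoid.Sum +-0-commutativeMonoid
  using (sum; sum-syntax; sum-cong-≗; sum-remove; sum-replicate-zero; ∑-distrib-+; ∑-comm)

-- Counting with finite sums

𝟙 : Bool → ℕ
𝟙 true  = 1
𝟙 false = 0

δ : ∀ {m} → Fin m → Fin m → ℕ
δ u v = 𝟙 (does (u ≟ v))

δ-refl : ∀ {m} (v : Fin m) → δ v v ≡ 1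
δ-refl v = cong 𝟙 (dec-true (v ≟ v) refl)

δ-≢ : ∀ {m} {u v : Fin m} → u ≢ v → δ u v ≡ 0
δ-≢ {u = u} {v} u≢v = cong 𝟙 (dec-false (u ≟ v) u≢v)

∑-δ : ∀ {k} (a : Fin k) → ∑[ y < k ] δ a y ≡ 1
∑-δ {suc k} zero    = cong suc (sum-replicate-zero k)
∑-δ {suc k} (suc a) = ∑-δ a

∑-1 : ∀ k → ∑[ y < k ] 1 ≡ k
∑-1 zero    = refl
∑-1 (suc k) = cong suc (∑-1 k)

sum-mono-≤ : ∀ {n} {f g : Fin n → ℕ} → (∀ i → f i ≤ g i) → sum f ≤ sum g
sum-mono-≤ {zero}  f≤g = z≤n
sum-mono-≤ {suc n} f≤g = +-mono-≤ (f≤g zero) (sum-mono-≤ (f≤g ∘ suc))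

sum-mono-< : ∀ {n} {f g : Fin n → ℕ} → (∀ i → f i ≤ g i) → ∀ a → f a < g a → sum f < sum g
sum-mono-< f≤g zero    fa<ga = +-mono-<-≤ fa<ga (sum-mono-≤ (f≤g ∘ suc))
sum-mono-< f≤g (suc a) fa<ga = +-mono-≤-< (f≤g zero) (sum-mono-< (f≤g ∘ suc) a fa<ga)

term≤sum : ∀ {n} (f : Fin n → ℕ) a → f a ≤ sum f
term≤sum {suc n} f a = subst (f a ≤_) (sym (sum-remove {i = a} f)) (m≤m+n (f a) _)

sum≡1⇒term≡1 : ∀ {n} (f : Fin n → ℕ) → sum f ≡ 1 → ∃ λ a → f a ≡ 1
sum≡1⇒term≡1 {suc n} f Σf≡1 with f zero in f₀≡
... | 1    = zero , f₀≡
... | zero = let a , fa≡1 = sum≡1⇒term≡1 (f ∘ suc) Σf≡1 in suc a , fa≡1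
sum≡1⇒term≡1 {suc n} f () | suc (suc _)

another-term≡1 : ∀ {n} (f : Fin n → ℕ) a → sum f ≡ 2 → f a ≡ 1 → ∃ λ b → b ≢ a × f b ≡ 1
another-term≡1 {suc n} f a Σf≡2 fa≡1 =
  let j , fj≡1 = sum≡1⇒term≡1 (removeAt f a) (+-cancelˡ-≡ 1 _ _ rest≡1)
  in punchIn a j , punchInᵢ≢i a j , fj≡1
  where
  rest≡1 : 1 + sum (removeAt f a) ≡ 1 + 1
  rest≡1 = trans (cong (_+ sum (removeAt f a)) (sym fa≡1)) (trans (sym (sum-remove {i = a} f)) Σf≡2)

sum-differ-at₁ : ∀ {n} {f g : Fin n → ℕ} a {c d} → (∀ i → i ≢ a → f i ≡ g i)
                 → c + f a ≡ d + g a → c + sum f ≡ d + sum g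
sum-differ-at₁ {suc n} {f} {g} a {c} {d} f≡g eq = begin
  c + sum f                      ≡⟨ cong (c +_) (sum-remove {i = a} f) ⟩
  c + (f a + sum (removeAt f a)) ≡⟨ sym (+-assoc c _ _) ⟩
  c + f a + sum (removeAt f a)   ≡⟨ cong₂ _+_ eq (sum-cong-≗ λ j → f≡g (punchIn a j) (punchInᵢ≢i a j)) ⟩
  d + g a + sum (removeAt g a)   ≡⟨ +-assoc d _ _ ⟩
  d + (g a + sum (removeAt g a)) ≡⟨ cong (d +_) (sym (sum-remove {i = a} g)) ⟩
  d + sum g                      ∎
  where open ≡-Reasoning

sum-differ-at₂ : ∀ {n} {f g : Fin n → ℕ} a b {d} → a ≢ b → (∀ i → i ≢ a → i ≢ b → f i ≡ g i)
                 → f a + f b ≡ d + (g a + g b) → sum f ≡ d + sum g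
sum-differ-at₂ {f = f} {g} a b {d} a≢b f≡g eq = +-cancelˡ-≡ (g a) _ _ (begin
  g a + sum f        ≡⟨ sum-differ-at₁ a f≡h (trans (+-comm (g a) (f a)) (cong (f a +_) (sym ha≡ga))) ⟩
  f a + sum h        ≡⟨ sum-differ-at₁ b h≡g (trans (cong (f a +_) hb≡fb) (trans eq (sym (+-assoc d _ _)))) ⟩
  d + g a + sum g    ≡⟨ xy∙z≈y∙xz d (g a) (sum g) ⟩
  g a + (d + sum g)  ∎)
  where
  open ≡-Reasoning
  h = updateAt f a (λ _ → g a)
  ha≡ga : h a ≡ g a
  ha≡ga = updateAt-updates a f
  hb≡fb : h b ≡ f b
  hb≡fb = updateAt-minimal b a f (a≢b ∘ sym)
  f≡h : ∀ i → i ≢ a → f i ≡ h i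
  f≡h i i≢a = sym (updateAt-minimal i a f i≢a)
  h≡g : ∀ i → i ≢ b → h i ≡ g i
  h≡g i i≢b with i ≟ a
  ... | yes refl = ha≡ga
  ... | no i≢a   = trans (sym (f≡h i i≢a)) (f≡g i i≢a i≢b)

count≡∑ : ∀ {m} (S : Fin m → Bool) → count S ≡ ∑[ e < m ] 𝟙 (S e)
count≡∑ {zero}  S = refl
count≡∑ {suc m} S with S zero
... | true  = cong suc (count≡∑ (S ∘ suc))
... | false = count≡∑ (S ∘ suc)

𝟙-mono : ∀ {s s′} → (s ≡ true → s′ ≡ true) → 𝟙 s ≤ 𝟙 s′
𝟙-mono {false}        _    = z≤n
𝟙-mono {true} {true}  _    = s≤s z≤n
𝟙-mono {true} {false} s⇒s′ = contradiction (s⇒s′ refl) λ ()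

count-< : ∀ {m} (S S′ : Fin m → Bool) → (∀ e → S e ≡ true → S′ e ≡ true)
          → ∀ e → S e ≡ false → S′ e ≡ true → count S < count S′
count-< S S′ S⊆S′ e Se S′e = subst₂ _<_ (sym (count≡∑ S)) (sym (count≡∑ S′))
  (sum-mono-< (λ i → 𝟙-mono (S⊆S′ i)) e (subst₂ _<_ (cong 𝟙 (sym Se)) (cong 𝟙 (sym S′e)) (s≤s z≤n)))

-- Double counting: summed over y, the numbers of edges of S that f sends to y give count S.
pigeonhole-miss : ∀ {n k} (S : Fin n → Bool) (f : Fin n → Fin k) → count S < k
                  → ∃ λ y → ∀ e → S e ≡ true → f e ≢ y
pigeonhole-miss {n} {k} S f |S|<k =
  let y , unhit = ¬∀⟶∃¬ k (λ y → 1 ≤ hits y) (λ y → 1 ≤? hits y) every-y-hit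
  in y , λ e e∈S fe≡y → unhit (hit e e∈S fe≡y)
  where
  hits : Fin k → ℕ
  hits y = ∑[ e < n ] (if S e then δ (f e) y else 0)
  ∑hits : ∑[ y < k ] hits y ≡ count S
  ∑hits = begin
    ∑[ y < k ] hits y                                    ≡⟨ ∑-comm (λ e y → if S e then δ (f e) y else 0) ⟨
    ∑[ e < n ] ∑[ y < k ] (if S e then δ (f e) y else 0) ≡⟨ sum-cong-≗ (λ e → per-edge e (S e)) ⟩
    ∑[ e < n ] 𝟙 (S e)                                   ≡⟨ count≡∑ S ⟨
    count S                                              ∎
    where
    open ≡-Reasoning
    per-edge : ∀ e s → ∑[ y < k ] (if s then δ (f e) y else 0) ≡ 𝟙 s
    per-edge e true  = ∑-δ (f e)
    per-edge e false = sum-replicate-zero k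
  every-y-hit : ¬ (∀ y → 1 ≤ hits y)
  every-y-hit all = <⇒≱ |S|<k (subst₂ _≤_ (∑-1 k) ∑hits (sum-mono-≤ all))
  hit : ∀ {y} e → S e ≡ true → f e ≡ y → 1 ≤ hits y
  hit e e∈S refl =
    subst (_≤ hits (f e)) (trans (cong (λ s → if s then δ (f e) (f e) else 0) e∈S) (δ-refl (f e)))
      (term≤sum _ e)

-- Balanced orientations of multigraphs with all degrees 0 or 2

Arc : ℕ → Set
Arc m = Fin m × Fin m

-- A multigraph on the vertices Fin m, loops allowed, whose arcs are labelled by Fin n;
-- the label e is unused when D e ≡ nothing.
Arcs : ℕ → ℕ → Set
Arcs n m = Fin n → Maybe (Arc m)

outAt inAt ends : ∀ {m} → Maybe (Arc m) → Fin m → ℕ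
outAt nothing        v = 0
outAt (just (u , _)) v = δ u v
inAt  nothing        v = 0
inAt  (just (_ , w)) v = δ w v
ends p v = outAt p v + inAt p v

orient : ∀ {m} → Bool → Maybe (Arc m) → Maybe (Arc m)
orient _     nothing        = nothing
orient true  (just a)       = just a
orient false (just (u , w)) = just (w , u)

find-arc : ∀ {n m} (D : Arcs n m) → (∃ λ e → ∃₂ λ u w → D e ≡ just (u , w)) ⊎ (∀ e → D e ≡ nothing)
find-arc {zero}  D = inj₂ λ ()
find-arc {suc n} D with D zero in D₀≡
... | just (u , w) = inj₁ (zero , u , w , D₀≡)
... | nothing with find-arc (D ∘ suc)
...   | inj₁ (e , arc) = inj₁ (suc e , arc)
...   | inj₂ no-arcs   = inj₂ λ { zero → D₀≡ ; (suc e) → no-arcs e }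

one-end-at : ∀ {m} {p : Maybe (Arc m)} {w} → ends p w ≡ 1 → ∃ λ z → p ≡ just (w , z) ⊎ p ≡ just (z , w)
one-end-at {p = nothing} ()
one-end-at {p = just (a , b)} {w} _ with a ≟ w | b ≟ w
... | yes refl | _        = b , inj₁ refl
... | no _     | yes refl = a , inj₂ refl
one-end-at {p = just (a , b)} {w} () | no _ | no _

orient-toward : ∀ {m} s {p : Maybe (Arc m)} {w z} → p ≡ just (w , z) ⊎ p ≡ just (z , w)
                → ∃ λ s′ → orient s′ p ≡ orient s (just (w , z))
orient-toward s     (inj₁ refl) = s , refl
orient-toward true  (inj₂ refl) = false , refl
orient-toward false (inj₂ refl) = true , refl

module _ {n m : ℕ} where

  outdeg indeg degree : Arcs n m → Fin m → ℕ
  outdeg D v = ∑[ e < n ] outAt (D e) v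
  indeg  D v = ∑[ e < n ] inAt (D e) v
  degree D v = ∑[ e < n ] ends (D e) v

  size : Arcs n m → ℕ
  size D = ∑[ e < n ] 𝟙 (is-just (D e))

  Balanced : Arcs n m → Set
  Balanced D = ∀ v → outdeg D v ≡ indeg D v

  DegreesZeroOrTwo : Arcs n m → Set
  DegreesZeroOrTwo D = ∀ v → degree D v ≡ 0 ⊎ degree D v ≡ 2

  reorient : (Fin n → Bool) → Arcs n m → Arcs n m
  reorient σ D e = orient (σ e) (D e)

  degree≡outdeg+indeg : ∀ D v → degree D v ≡ outdeg D v + indeg D v
  degree≡outdeg+indeg D v = ∑-distrib-+ (λ e → outAt (D e) v) (λ e → inAt (D e) v)

  degree-reorient : ∀ σ D v → degree (reorient σ D) v ≡ degree D v
  degree-reorient σ D v = sum-cong-≗ λ e → ends-orient (σ e) (D e)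
    where
    ends-orient : ∀ s p → ends (orient s p) v ≡ ends p v
    ends-orient _     nothing        = refl
    ends-orient true  (just _)       = refl
    ends-orient false (just (u , w)) = +-comm (δ w v) (δ u v)

  no-arcs-balanced : ∀ {D} σ → (∀ e → D e ≡ nothing) → Balanced (reorient σ D)
  no-arcs-balanced σ no-arcs v = sum-cong-≗ λ e →
    trans (cong (λ p → outAt (orient (σ e) p) v) (no-arcs e))
          (cong (λ p → inAt (orient (σ e) p) v) (sym (no-arcs e)))

  -- D′ is D with a loop at w deleted, or with a path through w short-cut.
  _⇝_at_ : Arcs n m → Arcs n m → Fin m → Set
  D ⇝ D′ at w = ∀ σ′ → ∃ λ σ → ∀ v →
    outdeg (reorient σ D) v ≡ δ w v + outdeg (reorient σ′ D′) v ×
    indeg (reorient σ D) v ≡ δ w v + indeg (reorient σ′ D′) v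

  ⇝-balanced : ∀ {D D′ w} → D ⇝ D′ at w
               → (∃ λ σ′ → Balanced (reorient σ′ D′)) → ∃ λ σ → Balanced (reorient σ D)
  ⇝-balanced {w = w} lift (σ′ , balanced) =
    let σ , counts = lift σ′
    in σ , λ v → trans (proj₁ (counts v)) (trans (cong (δ w v +_) (balanced v)) (sym (proj₂ (counts v))))

  ⇝-degree : ∀ {D D′ w} → D ⇝ D′ at w → ∀ v → degree D v ≡ (δ w v + δ w v) + degree D′ v
  ⇝-degree {D} {D′} {w} lift v = begin
    degree D v                                       ≡⟨ degree-reorient σ D v ⟨
    degree (reorient σ D) v                          ≡⟨ degree≡outdeg+indeg (reorient σ D) v ⟩
    outdeg (reorient σ D) v + indeg (reorient σ D) v ≡⟨ cong₂ _+_ out≡ in≡ ⟩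
    (δ w v + outdeg D₁ v) + (δ w v + indeg D₁ v)     ≡⟨ interchange (δ w v) _ (δ w v) _ ⟩
    (δ w v + δ w v) + (outdeg D₁ v + indeg D₁ v)     ≡⟨ cong (δ w v + δ w v +_) (degree≡outdeg+indeg D₁ v) ⟨
    (δ w v + δ w v) + degree D₁ v                    ≡⟨ cong (δ w v + δ w v +_) (degree-reorient _ D′ v) ⟩
    (δ w v + δ w v) + degree D′ v                    ∎
    where
    open ≡-Reasoning
    D₁ = reorient (λ _ → true) D′
    σ = proj₁ (lift (λ _ → true))
    out≡ = proj₁ (proj₂ (lift (λ _ → true)) v)
    in≡  = proj₂ (proj₂ (lift (λ _ → true)) v)

  ⇝-degreesZeroOrTwo : ∀ {D D′ w} → D ⇝ D′ at w → DegreesZeroOrTwo D → DegreesZeroOrTwo D′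
  ⇝-degreesZeroOrTwo {D} {D′} {w} lift zero-or-two v =
    lose-two (does (w ≟ v)) (⇝-degree {D} {D′} {w} lift v) (zero-or-two v)
    where
    lose-two : ∀ b {d d′} → d ≡ (𝟙 b + 𝟙 b) + d′ → d ≡ 0 ⊎ d ≡ 2 → d′ ≡ 0 ⊎ d′ ≡ 2
    lose-two false refl d∈02        = d∈02
    lose-two true  refl (inj₁ ())
    lose-two true  refl (inj₂ refl) = inj₁ refl

  Shortcut : Arcs n m → Set
  Shortcut D = ∃₂ λ D′ w → size D ≡ 1 + size D′ × D ⇝ D′ at w

  shortcut-loop : ∀ {D e u} → D e ≡ just (u , u) → Shortcut D
  shortcut-loop {D} {e} {u} De = D′ , u , differ-at-e (λ _ p → 𝟙 (is-just p)) refl , lift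
    where
    D′ = updateAt D e (λ _ → nothing)
    differ-at-e : (F : Fin n → Maybe (Arc m) → ℕ) {d : ℕ} → F e (just (u , u)) ≡ d + F e nothing
                  → ∑[ i < n ] F i (D i) ≡ d + ∑[ i < n ] F i (D′ i)
    differ-at-e F {d} eq = sum-differ-at₁ e {c = 0}
      (λ i i≢e → cong (F i) (sym (updateAt-minimal i e D i≢e)))
      (trans (cong (F e) De) (trans eq (cong (λ p → d + F e p) (sym (updateAt-updates e D)))))
    orient-loop : ∀ s → orient s (just (u , u)) ≡ just (u , u)
    orient-loop true  = refl
    orient-loop false = refl
    lift : D ⇝ D′ at u
    lift σ′ = σ′ , λ v →
      differ-at-e (λ i p → outAt (orient (σ′ i) p) v)
        (trans (cong (λ p → outAt p v) (orient-loop (σ′ e))) (sym (+-identityʳ _))) ,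
      differ-at-e (λ i p → inAt (orient (σ′ i) p) v)
        (trans (cong (λ p → inAt p v) (orient-loop (σ′ e))) (sym (+-identityʳ _)))

  -- The arcs e : u → w and g : w → z (g possibly reversed) become the single arc e : u → z.
  shortcut-path : ∀ {D e g u w z} → e ≢ g → D e ≡ just (u , w) → D g ≡ just (w , z) ⊎ D g ≡ just (z , w)
                  → Shortcut D
  shortcut-path {D} {e} {g} {u} {w} {z} e≢g De Dg = D′ , w , size≡ , lift
    where
    D′ = updateAt (updateAt D g (λ _ → nothing)) e (λ _ → just (u , z))
    D′e : D′ e ≡ just (u , z)
    D′e = updateAt-updates e _
    D′g : D′ g ≡ nothing
    D′g = trans (updateAt-minimal g e _ (e≢g ∘ sym)) (updateAt-updates g D)
    same : ∀ i → i ≢ e → i ≢ g → D i ≡ D′ i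
    same i i≢e i≢g = sym (trans (updateAt-minimal i e _ i≢e) (updateAt-minimal i g D i≢g))
    size≡ : size D ≡ 1 + size D′
    size≡ = sum-differ-at₂ e g e≢g (λ i i≢e i≢g → cong (𝟙 ∘ is-just) (same i i≢e i≢g))
      (trans (cong₂ _+_ (cong (𝟙 ∘ is-just) De) (cong 𝟙 ([ cong is-just , cong is-just ]′ Dg)))
             (cong₂ (λ p q → 1 + (𝟙 (is-just p) + 𝟙 (is-just q))) (sym D′e) (sym D′g)))
    -- u → w → z has the incidences of u → z plus a loop at w, in either direction.
    path-out : ∀ s v → outAt (orient s (just (u , w))) v + outAt (orient s (just (w , z))) v
                       ≡ δ w v + (outAt (orient s (just (u , z))) v + 0)
    path-out true  v = trans (+-comm (δ u v) (δ w v)) (cong (δ w v +_) (sym (+-identityʳ _)))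
    path-out false v = cong (δ w v +_) (sym (+-identityʳ _))
    path-in : ∀ s v → inAt (orient s (just (u , w))) v + inAt (orient s (just (w , z))) v
                      ≡ δ w v + (inAt (orient s (just (u , z))) v + 0)
    path-in true  v = cong (δ w v +_) (sym (+-identityʳ _))
    path-in false v = trans (+-comm (δ u v) (δ w v)) (cong (δ w v +_) (sym (+-identityʳ _)))
    lift : D ⇝ D′ at w
    lift σ′ = σ , λ v →
      differ-at-e-g (λ p → outAt p v) (path-out s v) , differ-at-e-g (λ p → inAt p v) (path-in s v)
      where
      s = σ′ e
      g-along = orient-toward s Dg
      σ = updateAt σ′ g (λ _ → proj₁ g-along)
      at-e : reorient σ D e ≡ orient s (just (u , w))
      at-e = cong₂ orient (updateAt-minimal e g σ′ e≢g) De
      at-g : reorient σ D g ≡ orient s (just (w , z))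
      at-g = trans (cong (λ t → orient t (D g)) (updateAt-updates g σ′)) (proj₂ g-along)
      at-e′ : reorient σ′ D′ e ≡ orient s (just (u , z))
      at-e′ = cong (orient s) D′e
      at-g′ : reorient σ′ D′ g ≡ nothing
      at-g′ = cong (orient (σ′ g)) D′g
      agree : ∀ i → i ≢ e → i ≢ g → reorient σ D i ≡ reorient σ′ D′ i
      agree i i≢e i≢g = cong₂ orient (updateAt-minimal i g σ′ i≢g) (same i i≢e i≢g)
      differ-at-e-g : (W : Maybe (Arc m) → ℕ) {d : ℕ}
        → W (orient s (just (u , w))) + W (orient s (just (w , z)))
          ≡ d + (W (orient s (just (u , z))) + W nothing)
        → ∑[ i < n ] W (reorient σ D i) ≡ d + ∑[ i < n ] W (reorient σ′ D′ i)
      differ-at-e-g W {d} path = sum-differ-at₂ e g e≢g (λ i i≢e i≢g → cong W (agree i i≢e i≢g))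
        (trans (cong₂ _+_ (cong W at-e) (cong W at-g))
               (trans path (cong (d +_) (sym (cong₂ _+_ (cong W at-e′) (cong W at-g′))))))

  shortcut : ∀ {D e u w} → DegreesZeroOrTwo D → D e ≡ just (u , w) → Shortcut D
  shortcut {D} {e} {u} {w} zero-or-two De with u ≟ w
  ... | yes refl = shortcut-loop De
  ... | no u≢w   =
    let g , g≢e , g-ends≡1 = another-term≡1 (λ i → ends (D i) w) e degree≡2 e-ends≡1
        z , Dg = one-end-at g-ends≡1
    in shortcut-path (g≢e ∘ sym) De Dg
    where
    e-ends≡1 : ends (D e) w ≡ 1
    e-ends≡1 = trans (cong (λ p → ends p w) De) (cong₂ _+_ (δ-≢ u≢w) (δ-refl w))
    degree≡2 : degree D w ≡ 2
    degree≡2 with zero-or-two w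
    ... | inj₂ d≡2 = d≡2
    ... | inj₁ d≡0 = contradiction (subst₂ _≤_ e-ends≡1 d≡0 (term≤sum (λ i → ends (D i) w) e)) λ ()

  eulerian-orientation : (D : Arcs n m) → DegreesZeroOrTwo D → ∃ λ σ → Balanced (reorient σ D)
  eulerian-orientation D = by-size (size D) D refl
    where
    by-size : ∀ c D → size D ≡ c → DegreesZeroOrTwo D → ∃ λ σ → Balanced (reorient σ D)
    by-size c D size≡c zero-or-two with find-arc D
    ... | inj₂ no-arcs          = (λ _ → true) , no-arcs-balanced _ no-arcs
    ... | inj₁ (_ , _ , _ , De) = recurse c size≡c (shortcut zero-or-two De)
      where
      recurse : ∀ c → size D ≡ c → Shortcut D → ∃ λ σ → Balanced (reorient σ D)
      recurse zero     size≡0 (_ , _ , size≡ , _)       = contradiction (trans (sym size≡) size≡0) λ ()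
      recurse (suc c′) size≡c (D′ , w , size≡ , lift) = ⇝-balanced {D} {D′} {w} lift
        (by-size c′ D′ (suc-injective (trans (sym size≡) size≡c))
                 (⇝-degreesZeroOrTwo {D} {D′} {w} lift zero-or-two))

-- Edge sets of a graph as multigraphs

arcs : (G : Graph) → (Fin (Graph.nE G) → Bool) → Arcs (Graph.nE G) (Graph.nV G)
arcs G S e = if S e then just (Graph.tail G e , Graph.head G e) else nothing

-- `deg` counts with a helper local to its definition, which cannot be named. The
-- metavariable `degFrom` is solved to that helper by unification in `degFrom-unfolds`.
mutual
  degFrom : ∀ nV nE (t h : Fin nE → Fin nV) → (∀ e → t e ≢ h e) → (Fin nE → Bool) → Fin nV
            → (k : ℕ) → (Fin k → Fin nE) → ℕ
  degFrom = _

  degFrom-unfolds : ∀ nV m t h l (S : Fin (suc m) → Bool) v → S zero ≡ false →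
    deg (record { nV = nV ; nE = suc m ; tail = t ; head = h ; loopless = l }) S v
    ≡ degFrom nV (suc m) t h l S v m suc
  degFrom-unfolds nV m t h l S v _ with S zero
  ... | false with suc m | t | h | l | S | (λ (i : Fin m) → suc i)
  ... | _ | _ | _ | _ | _ | _ = refl

[]≡𝟙 : ∀ G {p} {P : Set p} (d : Dec P) → [_] G d ≡ 𝟙 (does d)
[]≡𝟙 G (yes _) = refl
[]≡𝟙 G (no _)  = refl

degFrom≡∑ : ∀ nV nE t h l (S : Fin nE → Bool) v k (ι : Fin k → Fin nE) →
  let G = record { nV = nV ; nE = nE ; tail = t ; head = h ; loopless = l }
  in degFrom nV nE t h l S v k ι ≡ ∑[ i < k ] ends (arcs G S (ι i)) v
degFrom≡∑ nV nE t h l S v zero    ι = refl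
degFrom≡∑ nV nE t h l S v (suc k) ι with S (ι zero)
... | true  = cong₂ _+_ (cong₂ _+_ ([]≡𝟙 G (t (ι zero) ≟ v)) ([]≡𝟙 G (h (ι zero) ≟ v)))
                        (degFrom≡∑ nV nE t h l S v k (ι ∘ suc))
  where G = record { nV = nV ; nE = nE ; tail = t ; head = h ; loopless = l }
... | false = degFrom≡∑ nV nE t h l S v k (ι ∘ suc)

deg≡degree : ∀ G S v → deg G S v ≡ degree (arcs G S) v
deg≡degree G S v = degFrom≡∑ (Graph.nV G) (Graph.nE G) (Graph.tail G) (Graph.head G) (Graph.loopless G) S v
                             (Graph.nE G) (λ e → e)

IsCycle⇒DegreesZeroOrTwo : ∀ {G S} → IsCycle G S → DegreesZeroOrTwo (arcs G S)
IsCycle⇒DegreesZeroOrTwo {G} {S} (_ , zero-or-two , _) v =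
  subst (λ d → d ≡ 0 ⊎ d ≡ 2) (deg≡degree G S v) (zero-or-two v)

-- Flows around a cycle

module Flows {c ℓ} (B : AbelianGroup c ℓ) where

  open AbelianGroup B renaming (refl to ≈-refl; sym to ≈-sym; trans to ≈-trans)
  open import Algebra.Properties.Group group using (∙-cancelʳ; ⁻¹-injective; ε⁻¹≈ε; inverseʳ-unique)
  open import Algebra.Properties.CommutativeSemigroup commutativeSemigroup using ()
    renaming (interchange to ∙-interchange)
  open import Algebra.Properties.CommutativeMonoid.Mult commutativeMonoid
    using (×-homo-+; ×-distrib-+; ×-congʳ) renaming (_×_ to _·_)
  open import Algebra.Properties.CommutativeMonoid.Sum commutativeMonoid
    using () renaming (sum to ∑ᴮ; sum-cong-≋ to ∑ᴮ-cong; ∑-distrib-+ to ∑ᴮ-distrib-∙)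
  open import Relation.Binary.Reasoning.Setoid setoid

  ·-ε : ∀ k → k · ε ≈ ε
  ·-ε zero    = ≈-refl
  ·-ε (suc k) = ≈-trans (identityˡ _) (·-ε k)

  ∑ᴮ-· : ∀ {n} (f : Fin n → ℕ) x → ∑ᴮ (λ i → f i · x) ≈ sum f · x
  ∑ᴮ-· {zero}  f x = ≈-refl
  ∑ᴮ-· {suc n} f x = ≈-trans (∙-congˡ (∑ᴮ-· (f ∘ suc) x)) (≈-sym (×-homo-+ x (f zero) (sum (f ∘ suc))))

  sumIf≈∑ᴮ : ∀ {m p} {P : Fin m → Set p} (d : ∀ i → Dec (P i)) f
             → sumIf B d f ≈ ∑ᴮ (λ i → 𝟙 (does (d i)) · f i)
  sumIf≈∑ᴮ {zero}  d f = ≈-refl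
  sumIf≈∑ᴮ {suc m} d f with d zero
  ... | yes _ = ∙-cong (≈-sym (identityʳ (f zero))) (sumIf≈∑ᴮ (d ∘ suc) (f ∘ suc))
  ... | no _  = ≈-trans (sumIf≈∑ᴮ (d ∘ suc) (f ∘ suc)) (≈-sym (identityˡ _))

  sumIf-∙ : ∀ {m p} {P : Fin m → Set p} (d : ∀ i → Dec (P i)) f g →
            sumIf B d (λ i → f i ∙ g i) ≈ sumIf B d f ∙ sumIf B d g
  sumIf-∙ {zero}  d f g = ≈-sym (identityˡ ε)
  sumIf-∙ {suc m} d f g with d zero
  ... | yes _ = ≈-trans (∙-congˡ (sumIf-∙ (d ∘ suc) (f ∘ suc) (g ∘ suc))) (∙-interchange _ _ _ _)
  ... | no _  = sumIf-∙ (d ∘ suc) (f ∘ suc) (g ∘ suc)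

  IsFlow-∙ : ∀ {G f g} → IsFlow B G f → IsFlow B G g → IsFlow B G (λ e → f e ∙ g e)
  IsFlow-∙ {G} {f} {g} f-flow g-flow v = begin
    sumIf B out (λ e → f e ∙ g e)  ≈⟨ sumIf-∙ out f g ⟩
    sumIf B out f ∙ sumIf B out g  ≈⟨ ∙-cong (f-flow v) (g-flow v) ⟩
    sumIf B in′ f ∙ sumIf B in′ g  ≈⟨ sumIf-∙ in′ f g ⟨
    sumIf B in′ (λ e → f e ∙ g e)  ∎
    where
    out = λ e → Graph.tail G e ≟ v
    in′ = λ e → Graph.head G e ≟ v

  signed : Bool → Carrier → Carrier
  signed true  x = x
  signed false x = x ⁻¹

  cycleFlow : ∀ {n} (S σ : Fin n → Bool) → Carrier → Fin n → Carrier
  cycleFlow S σ x e = if S e then signed (σ e) x else ε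

  -- Adding (in-degree)·x to the outflow and (out-degree)·x to the inflow at v makes every
  -- edge contribute the same to both sides.
  cycleFlow-isFlow : ∀ G S σ → Balanced (reorient σ (arcs G S)) → ∀ x → IsFlow B G (cycleFlow S σ x)
  cycleFlow-isFlow G S σ balanced x v = ∙-cancelʳ (indeg D v · x) _ _ (begin
    sumIf B out φ ∙ indeg D v · x
      ≈⟨ ∙-cong (sumIf≈∑ᴮ out φ) (≈-sym (∑ᴮ-· (λ e → inAt (D e) v) x)) ⟩
    ∑ᴮ (λ e → δ (t e) v · φ e) ∙ ∑ᴮ (λ e → inAt (D e) v · x)
      ≈⟨ ∑ᴮ-distrib-∙ (λ e → δ (t e) v · φ e) (λ e → inAt (D e) v · x) ⟨
    ∑ᴮ (λ e → δ (t e) v · φ e ∙ inAt (D e) v · x)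
      ≈⟨ ∑ᴮ-cong edgewise ⟩
    ∑ᴮ (λ e → δ (h e) v · φ e ∙ outAt (D e) v · x)
      ≈⟨ ∑ᴮ-distrib-∙ (λ e → δ (h e) v · φ e) (λ e → outAt (D e) v · x) ⟩
    ∑ᴮ (λ e → δ (h e) v · φ e) ∙ ∑ᴮ (λ e → outAt (D e) v · x)
      ≈⟨ ∙-cong (≈-sym (sumIf≈∑ᴮ in′ φ)) (∑ᴮ-· (λ e → outAt (D e) v) x) ⟩
    sumIf B in′ φ ∙ outdeg D v · x
      ≡⟨ cong (λ d → sumIf B in′ φ ∙ d · x) (balanced v) ⟩
    sumIf B in′ φ ∙ indeg D v · x
      ∎)
    where
    t = Graph.tail G
    h = Graph.head G
    out = λ e → t e ≟ v
    in′ = λ e → h e ≟ v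
    D = reorient σ (arcs G S)
    φ = cycleFlow S σ x
    vanishes : ∀ k → k · ε ∙ 0 · x ≈ ε
    vanishes k = ≈-trans (identityʳ _) (·-ε k)
    cancels : ∀ k → k · (x ⁻¹) ∙ k · x ≈ ε
    cancels k = ≈-trans (≈-sym (×-distrib-+ (x ⁻¹) x k)) (≈-trans (×-congʳ k (inverseˡ x)) (·-ε k))
    edgewise : ∀ e → δ (t e) v · φ e ∙ inAt (D e) v · x ≈ δ (h e) v · φ e ∙ outAt (D e) v · x
    edgewise e with S e | σ e
    ... | false | _     = ≈-trans (vanishes (δ (t e) v)) (≈-sym (vanishes (δ (h e) v)))
    ... | true  | true  = comm _ _
    ... | true  | false = ≈-trans (cancels (δ (t e) v)) (≈-sym (cancels (δ (h e) v)))

  forbidden : Bool → Carrier → Carrier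
  forbidden true  y = y ⁻¹
  forbidden false y = y

  ∙-signed≈ε : ∀ s y x → y ∙ signed s x ≈ ε → x ≈ forbidden s y
  ∙-signed≈ε true  y x y∙x≈ε   = inverseʳ-unique y x y∙x≈ε
  ∙-signed≈ε false y x y∙x⁻¹≈ε = ⁻¹-injective (inverseʳ-unique y (x ⁻¹) y∙x⁻¹≈ε)

  forbidden-ε : ∀ s {y} → y ≈ ε → forbidden s y ≈ ε
  forbidden-ε true  y≈ε = ≈-trans (⁻¹-cong y≈ε) ε⁻¹≈ε
  forbidden-ε false y≈ε = y≈ε

  signed-≉ε : ∀ s {x} → ¬ x ≈ ε → ¬ signed s x ≈ ε
  signed-≉ε true  x≉ε       = x≉ε
  signed-≉ε false x≉ε x⁻¹≈ε = x≉ε (⁻¹-injective (≈-trans x⁻¹≈ε (≈-sym ε⁻¹≈ε)))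

-- Finite groups and supports

module FiniteGroup {c ℓ} (B : AbelianGroup c ℓ) {k} (fin : Finite B k) where

  open AbelianGroup B renaming (refl to ≈-refl; sym to ≈-sym; trans to ≈-trans)
  open Inverse fin using (to; from; to-cong; strictlyInverseˡ)

  finite-avoid : ∀ {n} (S : Fin n → Bool) (f : Fin n → Carrier) → count S < k
                 → ∃ λ x → ∀ e → S e ≡ true → ¬ x ≈ f e
  finite-avoid S f |S|<k =
    let y , missed = pigeonhole-miss S (to ∘ f) |S|<k
    in from y , λ e e∈S y≈fe → missed e e∈S (trans (sym (to-cong y≈fe)) (strictlyInverseˡ y))

  supp-≉ε : ∀ {m} (f : Fin m → Carrier) {e} → ¬ f e ≈ ε → supp B fin f e ≡ true
  supp-≉ε f {e} fe≉ε with finite-dec B fin (f e) ε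
  ... | yes fe≈ε = contradiction fe≈ε fe≉ε
  ... | no _     = refl

  supp-cong : ∀ {m} (f g : Fin m → Carrier) {e} → f e ≈ g e → supp B fin f e ≡ supp B fin g e
  supp-cong f g {e} fe≈ge with finite-dec B fin (f e) ε | finite-dec B fin (g e) ε
  ... | yes _    | yes _    = refl
  ... | no _     | no _     = refl
  ... | yes fe≈ε | no ge≉ε  = contradiction (≈-trans (≈-sym fe≈ge) fe≈ε) ge≉ε
  ... | no fe≉ε  | yes ge≈ε = contradiction (≈-trans fe≈ge ge≈ε) fe≉ε

  outside-supp : ∀ {m} (f : Fin m → Carrier) → ¬ (∀ e → supp B fin f e ≡ true)
                 → ∃ λ e → supp B fin f e ≡ false × f e ≈ ε
  outside-supp {m} f not-full =
    let e , not-true = ¬∀⟶∃¬ m (λ e → supp B fin f e ≡ true) (λ e → supp B fin f e ≟ᵇ true) not-full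
    in e , ¬-not not-true , decidable-stable (finite-dec B fin (f e) ε) (not-true ∘ supp-≉ε f)

≤∸1⇒< : ∀ {c k} → Fin k → c ≤ k ∸ 1 → c < k
≤∸1⇒< {k = suc k} _ c≤k = s≤s c≤k

-- Adding a cycle flow

module Augmentation {ca ℓa cb ℓb} (A : AbelianGroup ca ℓa) (B : AbelianGroup cb ℓb) {k} (fin : Finite B k)
  (G : Graph) {a : Fin (Graph.nE G) → AbelianGroup.Carrier A} {b : Fin (Graph.nE G) → AbelianGroup.Carrier B}
  (nz-flow : IsNZFlow A B G a b)
  {S σ : Fin (Graph.nE G) → Bool} (balanced : Balanced (reorient σ (arcs G S)))
  {x : AbelianGroup.Carrier B}
  (avoids : ∀ e → S e ≡ true → ¬ AbelianGroup._≈_ B x (Flows.forbidden B (σ e) (b e)))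
  {e₀ : Fin (Graph.nE G)} (e₀∈S : S e₀ ≡ true) (e₀∉supp : supp B fin b e₀ ≡ false)
  (b[e₀]≈ε : AbelianGroup._≈_ B (b e₀) (AbelianGroup.ε B))
  where

  open AbelianGroup B renaming (refl to ≈-refl; sym to ≈-sym; trans to ≈-trans)
  open import Algebra.Properties.Group group using (x∙y⁻¹≈ε⇒x≈y; x≈y⇒x∙y⁻¹≈ε; ∙-cancelˡ)
  open Flows B
  open FiniteGroup B fin

  φ : Fin (Graph.nE G) → Carrier
  φ = cycleFlow S σ x

  b′ : Fin (Graph.nE G) → Carrier
  b′ e = b e ∙ φ e

  φ-off-S : ∀ {e} → S e ≡ false → φ e ≡ ε
  φ-off-S {e} e∉S = cong (λ s → if s then signed (σ e) x else ε) e∉S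

  φ-on-S : ∀ {e} → S e ≡ true → φ e ≡ signed (σ e) x
  φ-on-S {e} e∈S = cong (λ s → if s then signed (σ e) x else ε) e∈S

  b′-off-S : ∀ {e} → S e ≡ false → b′ e ≈ b e
  b′-off-S {e} e∉S = ≈-trans (∙-congˡ (reflexive (φ-off-S e∉S))) (identityʳ (b e))

  b′-on-S : ∀ {e} → S e ≡ true → ¬ b′ e ≈ ε
  b′-on-S {e} e∈S b′≈ε =
    avoids e e∈S (∙-signed≈ε (σ e) (b e) x (≈-trans (∙-congˡ (reflexive (sym (φ-on-S e∈S)))) b′≈ε))

  x≉ε : ¬ x ≈ ε
  x≉ε x≈ε = avoids e₀ e₀∈S (≈-trans x≈ε (≈-sym (forbidden-ε (σ e₀) b[e₀]≈ε)))

  φ-≉ε : ∀ {e} → S e ≡ true → ¬ φ e ≈ ε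
  φ-≉ε {e} e∈S φ≈ε = signed-≉ε (σ e) x≉ε (≈-trans (reflexive (sym (φ-on-S e∈S))) φ≈ε)

  b′-isNZFlow : IsNZFlow A B G a b′
  b′-isNZFlow = a-flow , IsFlow-∙ {G} b-flow (cycleFlow-isFlow G S σ balanced x) , b′-nowhere-zero
    where
    a-flow = proj₁ nz-flow
    b-flow = proj₁ (proj₂ nz-flow)
    b′-nowhere-zero : NowhereZero A B G a b′
    b′-nowhere-zero e (ae≈ε , b′e≈ε) with S e ≟ᵇ true
    ... | yes e∈S = b′-on-S e∈S b′e≈ε
    ... | no  e∉S = proj₂ (proj₂ nz-flow) e (ae≈ε , ≈-trans (≈-sym (b′-off-S (¬-not e∉S))) b′e≈ε)

  adjacent : IsCycle G S → Adjacent A B G a b a b′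
  adjacent S-cycle = S , S-cycle , λ e → mk⇔ (differs-on-S e) (on-S-if-differs e)
    where
    differs-on-S : ∀ e → S e ≡ true → ¬ (_ × (b e ∙ b′ e ⁻¹) ≈ ε)
    differs-on-S e e∈S (_ , b≈b′) =
      φ-≉ε e∈S (≈-sym (∙-cancelˡ (b e) ε (φ e) (≈-trans (identityʳ (b e)) (x∙y⁻¹≈ε⇒x≈y _ _ b≈b′))))
    on-S-if-differs : ∀ e → ¬ (_ × (b e ∙ b′ e ⁻¹) ≈ ε) → S e ≡ true
    on-S-if-differs e differ with S e ≟ᵇ true
    ... | yes e∈S = e∈S
    ... | no  e∉S =
      contradiction (AbelianGroup.inverseʳ A (a e) , x≈y⇒x∙y⁻¹≈ε (≈-sym (b′-off-S (¬-not e∉S)))) differ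

  supp-grows : count (supp B fin b) < count (supp B fin b′)
  supp-grows = count-< _ _ supp⊆ e₀ e₀∉supp (supp-≉ε b′ (b′-on-S e₀∈S))
    where
    supp⊆ : ∀ e → supp B fin b e ≡ true → supp B fin b′ e ≡ true
    supp⊆ e e∈supp with S e ≟ᵇ true
    ... | yes e∈S = supp-≉ε b′ (b′-on-S e∈S)
    ... | no  e∉S = trans (supp-cong b′ b (b′-off-S (¬-not e∉S))) e∈supp

lemma6p2 : ∀ {ca ℓa cb ℓb} (A : AbelianGroup ca ℓa) (B : AbelianGroup cb ℓb)
    → (k : ℕ) (fin : Finite B k)
    → (G : Graph)
    → (∀ e → Σ (Fin (Graph.nE G) → Bool) λ S →
         IsCycle G S × S e ≡ true × length G S ≤ k ∸ 1)
    → (a : Fin (Graph.nE G) → AbelianGroup.Carrier A)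
    → (b : Fin (Graph.nE G) → AbelianGroup.Carrier B)
    → IsNZFlow A B G a b
    → ¬ (∀ e → supp B fin b e ≡ true)
    → Σ (Fin (Graph.nE G) → AbelianGroup.Carrier B) λ b′ →
        IsNZFlow A B G a b′
        × Adjacent A B G a b a b′
        × count (supp B fin b) < count (supp B fin b′)
lemma6p2 A B k fin G short-cycles a b nz-flow not-full =
  let e₀ , e₀∉supp , b[e₀]≈ε = outside-supp b not-full
      S , S-cycle , e₀∈S , |S|≤k∸1 = short-cycles e₀
      σ , balanced = eulerian-orientation (arcs G S) (IsCycle⇒DegreesZeroOrTwo S-cycle)
      |S|<k = ≤∸1⇒< (Inverse.to fin (AbelianGroup.ε B)) |S|≤k∸1
      x , avoids = finite-avoid S (λ e → forbidden (σ e) (b e)) |S|<k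
      open Augmentation A B fin G nz-flow balanced avoids e₀∈S e₀∉supp b[e₀]≈ε
  in b′ , b′-isNZFlow , adjacent S-cycle , supp-grows
  where
  open FiniteGroup B fin using (outside-supp; finite-avoid)
  open Flows B using (forbidden)
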